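{- Let $\mathbf A$ be a pseudo-Kleene lattice. Then $\mathbf A$ satisfies (SP1) (for all $x,y\in A$: if $x\leq y$ and $x'\land y=(x\land x')\lor(y\land y')$, then $y\land(x\lor x')=x\lor(y\land y')$) if and only if $\mathbf A$ has no subalgebra isomorphic to $\mathbf B_6$ and no subalgebra isomorphic to $\mathbf B_8$.
   Context: A pseudo-Kleene lattice is an algebra $(A,\land,\lor,{}',0,1)$ where $(A,\land,\lor,0,1)$ is a bounded lattice, ${}'$ is an antitone involution ($x\le y\Rightarrow y'\le x'$, $x''=x$), and $x\land x'\leq y\lor y'$ for all $x,y$. $\mathbf B_6$ is the pseudo-Kleene lattice with elements $0,x,y,y',x',1$, covers $0<x<y<1$ and $0<y'<x'<1$, and involution $0\leftrightarrow1$, $x\leftrightarrow x'$, $y\leftrightarrow y'$. $\mathbf B_8$ is the pseudo-Kleene lattice with elements $0,z',x,y,y',x',z,1$, covers $0<z'$, $z'<x<y<z$, $z'<y'<x'<z$, $z<1$, and involution $0\leftrightarrow1$, $x\leftrightarrow x'$, $y\leftrightarrow y'$, $z\leftrightarrow z'$. -}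

module Defs where

open import Level using (Level; _⊔_) renaming (suc to lsuc)
open import Data.Bool using (Bool; true; false; if_then_else_; _∧_)
open import Data.Product using (Σ; _×_; ∃)
open import Relation.Binary.PropositionalEquality using (_≡_)

record PKSig (a : Level) : Set (lsuc a) where
  field
    Carrier : Set a
    _⊓_     : Carrier → Carrier → Carrier
    _⊔ₗ_    : Carrier → Carrier → Carrier
    _′      : Carrier → Carrier
    ⊥ₗ      : Carrier
    ⊤ₗ      : Carrier
  infixr 7 _⊓_
  infixr 6 _⊔ₗ_
  infix  8 _′

  _≤_ : Carrier → Carrier → Set a
  x ≤ y = x ⊓ y ≡ x

record PseudoKleeneLattice (a : Level) : Set (lsuc a) where
  field
    sig : PKSig a
  open PKSig sig public
  field
    ⊓-comm    : ∀ x y → x ⊓ y ≡ y ⊓ x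
    ⊔-comm    : ∀ x y → x ⊔ₗ y ≡ y ⊔ₗ x
    ⊓-assoc   : ∀ x y z → (x ⊓ y) ⊓ z ≡ x ⊓ (y ⊓ z)
    ⊔-assoc   : ∀ x y z → (x ⊔ₗ y) ⊔ₗ z ≡ x ⊔ₗ (y ⊔ₗ z)
    ⊓-absorb  : ∀ x y → x ⊓ (x ⊔ₗ y) ≡ x
    ⊔-absorb  : ∀ x y → x ⊔ₗ (x ⊓ y) ≡ x
    ⊥-least   : ∀ x → ⊥ₗ ≤ x
    ⊤-greatest : ∀ x → x ≤ ⊤ₗ
    ′-antitone : ∀ x y → x ≤ y → (y ′) ≤ (x ′)
    ′-invol    : ∀ x → (x ′) ′ ≡ x
    normal     : ∀ x y → (x ⊓ x ′) ≤ (y ⊔ₗ y ′)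

-- Embeddings (injective homomorphisms); "A has a subalgebra isomorphic
-- to B" means there is an injective homomorphism B → A.

record Embedding {b a : Level} (B : PKSig b) (A : PKSig a) : Set (a ⊔ b) where
  private
    module B = PKSig B
    module A = PKSig A
  field
    f        : B.Carrier → A.Carrier
    injective : ∀ x y → f x ≡ f y → x ≡ y
    pres-⊓   : ∀ x y → f (x B.⊓ y) ≡ f x A.⊓ f y
    pres-⊔   : ∀ x y → f (x B.⊔ₗ y) ≡ f x A.⊔ₗ f y
    pres-′   : ∀ x → f (x B.′) ≡ (f x) A.′
    pres-⊥   : f B.⊥ₗ ≡ A.⊥ₗ
    pres-⊤   : f B.⊤ₗ ≡ A.⊤ₗ

HasSubalgebraIsoTo : {b a : Level} → PKSig b → PKSig a → Set (a ⊔ b)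
HasSubalgebraIsoTo B A = Embedding B A

-- B6 : 0 < x < y < 1 and 0 < y′ < x′ < 1.

data B6 : Set where
  o6 x6 y6 y6′ x6′ i6 : B6

leq6 : B6 → B6 → Bool
leq6 o6 _ = true
leq6 _ i6 = true
leq6 x6 x6 = true
leq6 x6 y6 = true
leq6 y6 y6 = true
leq6 y6′ y6′ = true
leq6 y6′ x6′ = true
leq6 x6′ x6′ = true
leq6 _ _ = false

meet6 : B6 → B6 → B6
meet6 p q = if leq6 p q then p else (if leq6 q p then q else o6)

join6 : B6 → B6 → B6
join6 p q = if leq6 p q then q else (if leq6 q p then p else i6)

neg6 : B6 → B6
neg6 o6 = i6
neg6 i6 = o6
neg6 x6 = x6′
neg6 x6′ = x6
neg6 y6 = y6′
neg6 y6′ = y6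

𝐁₆ : PKSig Level.zero
𝐁₆ = record { Carrier = B6 ; _⊓_ = meet6 ; _⊔ₗ_ = join6 ; _′ = neg6
            ; ⊥ₗ = o6 ; ⊤ₗ = i6 }

-- B8 : 0 < z′ ; z′ < x < y < z ; z′ < y′ < x′ < z ; z < 1.

data B8 : Set where
  o8 z8′ x8 y8 y8′ x8′ z8 i8 : B8

leq8 : B8 → B8 → Bool
leq8 o8 _ = true
leq8 _ i8 = true
leq8 z8′ o8 = false
leq8 z8′ _ = true
leq8 i8 z8 = false
leq8 _ z8 = true
leq8 x8 x8 = true
leq8 x8 y8 = true
leq8 y8 y8 = true
leq8 y8′ y8′ = true
leq8 y8′ x8′ = true
leq8 x8′ x8′ = true
leq8 _ _ = false

meet8 : B8 → B8 → B8
meet8 p q = if leq8 p q then p else (if leq8 q p then q else z8′)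

join8 : B8 → B8 → B8
join8 p q = if leq8 p q then q else (if leq8 q p then p else z8)

neg8 : B8 → B8
neg8 o8 = i8
neg8 i8 = o8
neg8 x8 = x8′
neg8 x8′ = x8
neg8 y8 = y8′
neg8 y8′ = y8
neg8 z8 = z8′
neg8 z8′ = z8

𝐁₈ : PKSig Level.zero
𝐁₈ = record { Carrier = B8 ; _⊓_ = meet8 ; _⊔ₗ_ = join8 ; _′ = neg8
            ; ⊥ₗ = o8 ; ⊤ₗ = i8 }

SP1 : {a : Level} → PseudoKleeneLattice a → Set a
SP1 A = ∀ x y → x ≤ y → (x ′) ⊓ y ≡ (x ⊓ x ′) ⊔ₗ (y ⊓ y ′) →
        y ⊓ (x ⊔ₗ x ′) ≡ x ⊔ₗ (y ⊓ y ′)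
  where open PseudoKleeneLattice A

-- Subalgebras inherit (SP1), and B6 and B8 violate it at x ≤ y. Conversely, let (SP1) fail
-- at x ≤ y and put u = x ∨ (y ∧ y′), v = y ∧ (x ∨ x′), so that u < v. The hypothesis
-- x′ ∧ y = (x ∧ x′) ∨ (y ∧ y′) gives v ∧ u′ ≤ x′ ∧ y ≤ u ∧ v′, which forces the four meets
-- u ∧ u′, u ∧ v′, v ∧ v′, v ∧ u′ to coincide with w = u ∧ v′. Then 0, w, u, v, v′, u′, w′, 1
-- is a copy of B8, or of B6 when w = 0. Since B6 and B8 are finite, being an embedding reduces
-- to finitely many facts about the images plus facts about B6 and B8 decided by evaluation;
-- injectivity holds because the kernel of a homomorphism is closed under unary polynomials,
-- and polynomials move any two distinct elements onto {x, y} (or, in B8, onto {0, z′}).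
module Submission where

open import Defs
open import Level using (Level)
open import Axiom.ExcludedMiddle using (ExcludedMiddle)
open import Data.Bool using (Bool; true; false; if_then_else_)
import Data.Bool.Properties as Bool
open import Data.Empty using (⊥-elim)
open import Data.Fin using (Fin)
import Data.Fin.Properties as Fin
open import Data.List using (List; []; _∷_; length; lookup)
open import Data.List.Membership.Propositional using (_∈_)
import Data.List.Membership.DecPropositional as DecMembership
open import Data.List.Relation.Unary.All as All using (All; []; _∷_)
open import Data.List.Relation.Unary.Any as Any using (Any; here; there; any?; satisfied)
open import Data.List.Relation.Unary.Any.Properties using (lookup-index)
open import Data.Product using (_×_; _,_; uncurry)
import Data.Product.Properties as Product
open import Data.Sum using (_⊎_; inj₁; inj₂; [_,_]′)
open import Function.Base using (_∘_)
open import Function.Bundles using (_⇔_; mk⇔)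
open import Relation.Binary.Definitions using (DecidableEquality)
open import Relation.Nullary using (¬_; Dec; yes; no)
open import Relation.Nullary.Decidable using (map′; from-yes; decidable-stable; _⊎-dec_; _→-dec_)
open import Relation.Unary using (Decidable)
open import Relation.Binary.PropositionalEquality

module Properties {a} (A : PseudoKleeneLattice a) where
  open PseudoKleeneLattice A
  open ≡-Reasoning

  ⊓-idem : ∀ x → x ⊓ x ≡ x
  ⊓-idem x = begin
    x ⊓ x             ≡⟨ cong (x ⊓_) (sym (⊔-absorb x x)) ⟩
    x ⊓ (x ⊔ₗ x ⊓ x)  ≡⟨ ⊓-absorb x (x ⊓ x) ⟩
    x                 ∎

  ≤-refl : ∀ {x} → x ≤ x
  ≤-refl = ⊓-idem _

  ≤-trans : ∀ {x y z} → x ≤ y → y ≤ z → x ≤ z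
  ≤-trans {x} {y} {z} x≤y y≤z = begin
    x ⊓ z        ≡⟨ cong (_⊓ z) (sym x≤y) ⟩
    (x ⊓ y) ⊓ z  ≡⟨ ⊓-assoc x y z ⟩
    x ⊓ (y ⊓ z)  ≡⟨ cong (x ⊓_) y≤z ⟩
    x ⊓ y        ≡⟨ x≤y ⟩
    x            ∎

  ≤-antisym : ∀ {x y} → x ≤ y → y ≤ x → x ≡ y
  ≤-antisym {x} {y} x≤y y≤x = trans (sym x≤y) (trans (⊓-comm x y) y≤x)

  x⊓y≤x : ∀ x y → (x ⊓ y) ≤ x
  x⊓y≤x x y = begin
    (x ⊓ y) ⊓ x  ≡⟨ ⊓-comm (x ⊓ y) x ⟩
    x ⊓ (x ⊓ y)  ≡⟨ sym (⊓-assoc x x y) ⟩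
    (x ⊓ x) ⊓ y  ≡⟨ cong (_⊓ y) (⊓-idem x) ⟩
    x ⊓ y        ∎

  x⊓y≤y : ∀ x y → (x ⊓ y) ≤ y
  x⊓y≤y x y = trans (⊓-assoc x y y) (cong (x ⊓_) (⊓-idem y))

  ⊓-greatest : ∀ {x y z} → z ≤ x → z ≤ y → z ≤ (x ⊓ y)
  ⊓-greatest {x} {y} {z} z≤x z≤y = trans (sym (⊓-assoc z x y)) (trans (cong (_⊓ y) z≤x) z≤y)

  ⊓-mono : ∀ {x₁ x₂ y₁ y₂} → x₁ ≤ x₂ → y₁ ≤ y₂ → (x₁ ⊓ y₁) ≤ (x₂ ⊓ y₂)
  ⊓-mono x₁≤x₂ y₁≤y₂ = ⊓-greatest (≤-trans (x⊓y≤x _ _) x₁≤x₂) (≤-trans (x⊓y≤y _ _) y₁≤y₂)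

  x≤x⊔y : ∀ x y → x ≤ (x ⊔ₗ y)
  x≤x⊔y = ⊓-absorb

  y≤x⊔y : ∀ x y → y ≤ (x ⊔ₗ y)
  y≤x⊔y x y = subst (y ≤_) (⊔-comm y x) (⊓-absorb y x)

  ≤⇒⊔≡ : ∀ {x y} → x ≤ y → x ⊔ₗ y ≡ y
  ≤⇒⊔≡ {x} {y} x≤y = begin
    x ⊔ₗ y      ≡⟨ cong (_⊔ₗ y) (sym x≤y) ⟩
    x ⊓ y ⊔ₗ y  ≡⟨ ⊔-comm (x ⊓ y) y ⟩
    y ⊔ₗ x ⊓ y  ≡⟨ cong (y ⊔ₗ_) (⊓-comm x y) ⟩
    y ⊔ₗ y ⊓ x  ≡⟨ ⊔-absorb y x ⟩
    y           ∎

  ⊔≡⇒≤ : ∀ {x y} → x ⊔ₗ y ≡ y → x ≤ y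
  ⊔≡⇒≤ {x} {y} x⊔y≡y = trans (cong (x ⊓_) (sym x⊔y≡y)) (⊓-absorb x y)

  ⊔-least : ∀ {x y z} → x ≤ z → y ≤ z → (x ⊔ₗ y) ≤ z
  ⊔-least {x} {y} {z} x≤z y≤z = ⊔≡⇒≤ (begin
    (x ⊔ₗ y) ⊔ₗ z  ≡⟨ ⊔-assoc x y z ⟩
    x ⊔ₗ (y ⊔ₗ z)  ≡⟨ cong (x ⊔ₗ_) (≤⇒⊔≡ y≤z) ⟩
    x ⊔ₗ z         ≡⟨ ≤⇒⊔≡ x≤z ⟩
    z              ∎)

  ′-swap : ∀ {x y} → x ≤ (y ′) → y ≤ (x ′)
  ′-swap {x} {y} x≤y′ = subst (_≤ (x ′)) (′-invol y) (′-antitone x (y ′) x≤y′)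

  ⊔-′ : ∀ x y → (x ⊔ₗ y) ′ ≡ x ′ ⊓ y ′
  ⊔-′ x y = ≤-antisym
    (⊓-greatest (′-antitone _ _ (x≤x⊔y x y)) (′-antitone _ _ (y≤x⊔y x y)))
    (′-swap (⊔-least (′-swap (x⊓y≤x (x ′) (y ′))) (′-swap (x⊓y≤y (x ′) (y ′)))))

  ⊓-′ : ∀ x y → (x ⊓ y) ′ ≡ x ′ ⊔ₗ y ′
  ⊓-′ x y = begin
    (x ⊓ y) ′              ≡⟨ cong _′ (cong₂ _⊓_ (′-invol x) (′-invol y)) ⟨
    (x ′ ′ ⊓ y ′ ′) ′      ≡⟨ cong _′ (⊔-′ (x ′) (y ′)) ⟨
    (x ′ ⊔ₗ y ′) ′ ′       ≡⟨ ′-invol _ ⟩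
    x ′ ⊔ₗ y ′             ∎

  ⊓-self-′ : ∀ x → x ⊓ x ′ ≡ (x ⊔ₗ x ′) ′
  ⊓-self-′ x = begin
    x ⊓ x ′        ≡⟨ ⊓-comm x (x ′) ⟩
    x ′ ⊓ x        ≡⟨ cong (x ′ ⊓_) (′-invol x) ⟨
    x ′ ⊓ x ′ ′    ≡⟨ ⊔-′ x (x ′) ⟨
    (x ⊔ₗ x ′) ′   ∎

  ⊥-′ : ⊥ₗ ′ ≡ ⊤ₗ
  ⊥-′ = ≤-antisym (⊤-greatest _) (′-swap (⊥-least _))

  ⊤-′ : ⊤ₗ ′ ≡ ⊥ₗ
  ⊤-′ = trans (cong _′ (sym ⊥-′)) (′-invol ⊥ₗ)

  module MeetsWithComplements {s t} (s≤t : s ≤ t) (squeeze : (t ⊓ s ′) ≤ (s ⊓ t ′)) where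
    t′≤s′ : (t ′) ≤ (s ′)
    t′≤s′ = ′-antitone s t s≤t

    s⊓s′≡s⊓t′ : s ⊓ s ′ ≡ s ⊓ t ′
    s⊓s′≡s⊓t′ = ≤-antisym (≤-trans (⊓-mono s≤t ≤-refl) squeeze) (⊓-mono ≤-refl t′≤s′)

    t⊓t′≡s⊓t′ : t ⊓ t ′ ≡ s ⊓ t ′
    t⊓t′≡s⊓t′ = ≤-antisym (≤-trans (⊓-mono ≤-refl t′≤s′) squeeze) (⊓-mono s≤t ≤-refl)

    t⊓s′≡s⊓t′ : t ⊓ s ′ ≡ s ⊓ t ′
    t⊓s′≡s⊓t′ = ≤-antisym squeeze (≤-trans (⊓-mono s≤t ≤-refl) (⊓-mono ≤-refl t′≤s′))

module _ {b} (B : PKSig b) where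
  open PKSig B

  data Translation : Set b where
    meetWith joinWith : Carrier → Translation
    complement        : Translation

  translate : Translation → Carrier → Carrier
  translate (meetWith c) p = c ⊓ p
  translate (joinWith c) p = c ⊔ₗ p
  translate complement   p = p ′

  Polynomial : Set b
  Polynomial = List Translation

  apply : Polynomial → Carrier → Carrier
  apply []      p = p
  apply (t ∷ P) p = apply P (translate t p)

  UnorderedIn : List (Carrier × Carrier) → Carrier → Carrier → Set b
  UnorderedIn pairs p q = (p , q) ∈ pairs ⊎ (q , p) ∈ pairs

  OrderSpannedBy : (Carrier → Carrier → Bool) → List (Carrier × Carrier) → Set b
  OrderSpannedBy _≤ᵇ_ order =
    ∀ p q → p ≤ᵇ q ≡ true → p ≡ q ⊎ p ≡ ⊥ₗ ⊎ q ≡ ⊤ₗ ⊎ (p , q) ∈ order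

  IncomparablesIn : (Carrier → Carrier → Bool) → List (Carrier × Carrier) → Set b
  IncomparablesIn _≤ᵇ_ pairs =
    ∀ p q → p ≤ᵇ q ≡ false → q ≤ᵇ p ≡ false → UnorderedIn pairs p q

  DeMorgan : Set b
  DeMorgan = ∀ p q → p ⊔ₗ q ≡ (p ′ ⊓ q ′) ′

  SeparatedBy : List Polynomial → List (Carrier × Carrier) → Set b
  SeparatedBy tests forbidden =
    ∀ p q → p ≡ q ⊎ Any (λ P → UnorderedIn forbidden (apply P p) (apply P q)) tests

-- Finite data on B from which an embedding into a pseudo-Kleene lattice is certified by
-- finitely many facts about the images: the meet of B is read off a Boolean order, with a
-- fixed value on incomparable pairs, and the tests separate distinct elements.
record Presentation {b} (B : PKSig b) : Set b where
  open PKSig B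
  field
    _≤ᵇ_          : Carrier → Carrier → Bool
    ⊓-default     : Carrier
    ⊓-by-order    : ∀ p q → p ⊓ q ≡ (if p ≤ᵇ q then p else if q ≤ᵇ p then q else ⊓-default)
    order         : List (Carrier × Carrier)
    order-spanned : OrderSpannedBy B _≤ᵇ_ order
    incomparable  : List (Carrier × Carrier)
    incomparables : IncomparablesIn B _≤ᵇ_ incomparable
    de-Morgan     : DeMorgan B
    tests         : List (Polynomial B)
    forbidden     : List (Carrier × Carrier)
    separated     : SeparatedBy B tests forbidden

module Decision {b} (B : PKSig b) (elements : List (PKSig.Carrier B))
                (complete : ∀ p → p ∈ elements) where
  open PKSig B

  position : Carrier → Fin (length elements)
  position p = Any.index (complete p)

  _≟_ : DecidableEquality Carrier
  p ≟ q = map′ position-injective (cong position) (position p Fin.≟ position q)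
    where
    position-injective : position p ≡ position q → p ≡ q
    position-injective e = trans (lookup-index (complete p))
      (trans (cong (lookup elements) e) (sym (lookup-index (complete q))))

  ∀? : ∀ {ℓ} {P : Carrier → Set ℓ} → Decidable P → Dec (∀ p → P p)
  ∀? P? = map′ (λ all p → All.lookup all (complete p)) (λ all → All.tabulate (λ {p} _ → all p))
               (All.all? P? elements)

  open DecMembership (Product.≡-dec _≟_ _≟_) using (_∈?_)

  unorderedIn? : ∀ pairs p q → Dec (UnorderedIn B pairs p q)
  unorderedIn? pairs p q = ((p , q) ∈? pairs) ⊎-dec ((q , p) ∈? pairs)

  orderSpannedBy? : ∀ _≤ᵇ_ order → Dec (OrderSpannedBy B _≤ᵇ_ order)
  orderSpannedBy? _≤ᵇ_ order = ∀? λ p → ∀? λ q →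
    ((p ≤ᵇ q) Bool.≟ true) →-dec (p ≟ q ⊎-dec (p ≟ ⊥ₗ ⊎-dec (q ≟ ⊤ₗ ⊎-dec ((p , q) ∈? order))))

  incomparablesIn? : ∀ _≤ᵇ_ pairs → Dec (IncomparablesIn B _≤ᵇ_ pairs)
  incomparablesIn? _≤ᵇ_ pairs = ∀? λ p → ∀? λ q →
    ((p ≤ᵇ q) Bool.≟ false) →-dec (((q ≤ᵇ p) Bool.≟ false) →-dec unorderedIn? pairs p q)

  deMorgan? : Dec (DeMorgan B)
  deMorgan? = ∀? λ p → ∀? λ q → (p ⊔ₗ q) ≟ ((p ′ ⊓ q ′) ′)

  separatedBy? : ∀ tests forbidden → Dec (SeparatedBy B tests forbidden)
  separatedBy? tests forbidden = ∀? λ p → ∀? λ q →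
    (p ≟ q) ⊎-dec any? (λ P → unorderedIn? forbidden (apply B P p) (apply B P q)) tests

module EmbeddingCriterion
  {a b} (A : PseudoKleeneLattice a) {B : PKSig b} (𝒫 : Presentation B) where
  open PseudoKleeneLattice A
  open Presentation 𝒫
  open Properties A
  open PKSig B using () renaming (_⊓_ to _⊓ᴮ_; _⊔ₗ_ to _⊔ᴮ_; _′ to _′ᴮ)
  open ≡-Reasoning

  module _
    (h : PKSig.Carrier B → Carrier)
    (h-⊥ : h (PKSig.⊥ₗ B) ≡ ⊥ₗ) (h-⊤ : h (PKSig.⊤ₗ B) ≡ ⊤ₗ)
    (h-′ : ∀ p → h (p ′ᴮ) ≡ h p ′)
    (h-order : All (uncurry λ p q → h p ≤ h q) order)
    (h-incomparable : All (uncurry λ p q → h p ⊓ h q ≡ h ⊓-default) incomparable)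
    (h-forbidden : All (uncurry λ p q → h p ≢ h q) forbidden)
    where

    h-monotone : ∀ p q → p ≤ᵇ q ≡ true → h p ≤ h q
    h-monotone p q p≤q with order-spanned p q p≤q
    ... | inj₁ refl                    = ≤-refl
    ... | inj₂ (inj₁ refl)             = subst (_≤ h q) (sym h-⊥) (⊥-least (h q))
    ... | inj₂ (inj₂ (inj₁ refl))      = subst (h p ≤_) (sym h-⊤) (⊤-greatest (h p))
    ... | inj₂ (inj₂ (inj₂ pq∈order)) = All.lookup h-order pq∈order

    h-incomparable-⊓ : ∀ p q → p ≤ᵇ q ≡ false → q ≤ᵇ p ≡ false → h p ⊓ h q ≡ h ⊓-default
    h-incomparable-⊓ p q p≰q q≰p =
      [ All.lookup h-incomparable
      , (λ qp∈ → trans (⊓-comm (h p) (h q)) (All.lookup h-incomparable qp∈)) ]′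
      (incomparables p q p≰q q≰p)

    h-⊓-by-order : ∀ p q →
      h (if p ≤ᵇ q then p else if q ≤ᵇ p then q else ⊓-default) ≡ h p ⊓ h q
    h-⊓-by-order p q with p ≤ᵇ q in p≤ᵇq
    ... | true = sym (h-monotone p q p≤ᵇq)
    ... | false with q ≤ᵇ p in q≤ᵇp
    ...   | true  = trans (sym (h-monotone q p q≤ᵇp)) (⊓-comm (h q) (h p))
    ...   | false = sym (h-incomparable-⊓ p q p≤ᵇq q≤ᵇp)

    h-⊓ : ∀ p q → h (p ⊓ᴮ q) ≡ h p ⊓ h q
    h-⊓ p q = trans (cong h (⊓-by-order p q)) (h-⊓-by-order p q)

    h-⊔ : ∀ p q → h (p ⊔ᴮ q) ≡ h p ⊔ₗ h q
    h-⊔ p q = begin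
      h (p ⊔ᴮ q)               ≡⟨ cong h (de-Morgan p q) ⟩
      h ((p ′ᴮ ⊓ᴮ q ′ᴮ) ′ᴮ)    ≡⟨ h-′ _ ⟩
      h (p ′ᴮ ⊓ᴮ q ′ᴮ) ′       ≡⟨ cong _′ (h-⊓ _ _) ⟩
      (h (p ′ᴮ) ⊓ h (q ′ᴮ)) ′  ≡⟨ cong _′ (cong₂ _⊓_ (h-′ p) (h-′ q)) ⟩
      (h p ′ ⊓ h q ′) ′        ≡⟨ ⊓-′ _ _ ⟩
      h p ′ ′ ⊔ₗ h q ′ ′       ≡⟨ cong₂ _⊔ₗ_ (′-invol _) (′-invol _) ⟩
      h p ⊔ₗ h q               ∎

    h-translate : ∀ t {p q} → h p ≡ h q → h (translate B t p) ≡ h (translate B t q)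
    h-translate (meetWith c) {p} {q} e = trans (h-⊓ c p) (trans (cong (h c ⊓_) e) (sym (h-⊓ c q)))
    h-translate (joinWith c) {p} {q} e = trans (h-⊔ c p) (trans (cong (h c ⊔ₗ_) e) (sym (h-⊔ c q)))
    h-translate complement   {p} {q} e = trans (h-′ p) (trans (cong _′ e) (sym (h-′ q)))

    h-apply : ∀ P {p q} → h p ≡ h q → h (apply B P p) ≡ h (apply B P q)
    h-apply []      e = e
    h-apply (t ∷ P) e = h-apply P (h-translate t e)

    h-apart : ∀ {p q} → UnorderedIn B forbidden p q → h p ≢ h q
    h-apart (inj₁ pq∈) = All.lookup h-forbidden pq∈
    h-apart (inj₂ qp∈) = All.lookup h-forbidden qp∈ ∘ sym

    h-injective : ∀ p q → h p ≡ h q → p ≡ q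
    h-injective p q hp≡hq with separated p q
    ... | inj₁ p≡q       = p≡q
    ... | inj₂ separator with satisfied separator
    ...   | P , apart    = ⊥-elim (h-apart apart (h-apply P hp≡hq))

    embedding : Embedding B sig
    embedding = record
      { f = h ; injective = h-injective ; pres-⊓ = h-⊓ ; pres-⊔ = h-⊔ ; pres-′ = h-′
      ; pres-⊥ = h-⊥ ; pres-⊤ = h-⊤ }

B6-elements : List B6
B6-elements = o6 ∷ x6 ∷ y6 ∷ y6′ ∷ x6′ ∷ i6 ∷ []

B6-complete : ∀ p → p ∈ B6-elements
B6-complete o6  = here refl
B6-complete x6  = there (here refl)
B6-complete y6  = there (there (here refl))
B6-complete y6′ = there (there (there (here refl)))
B6-complete x6′ = there (there (there (there (here refl))))
B6-complete i6  = there (there (there (there (there (here refl)))))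

B6-presentation : Presentation 𝐁₆
B6-presentation = record
  { _≤ᵇ_ = leq6 ; ⊓-default = o6 ; ⊓-by-order = λ _ _ → refl
  ; order = order ; order-spanned = from-yes (orderSpannedBy? leq6 order)
  ; incomparable = incomparable ; incomparables = from-yes (incomparablesIn? leq6 incomparable)
  ; de-Morgan = from-yes deMorgan?
  ; tests = tests ; forbidden = forbidden ; separated = from-yes (separatedBy? tests forbidden)
  }
  where
  open Decision 𝐁₆ B6-elements B6-complete
  order incomparable forbidden : List (B6 × B6)
  order        = (x6 , y6) ∷ (y6′ , x6′) ∷ []
  incomparable = (x6 , y6′) ∷ (x6 , x6′) ∷ (y6 , y6′) ∷ (y6 , x6′) ∷ []
  forbidden    = (x6 , y6) ∷ []
  tests : List (Polynomial 𝐁₆)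
  tests = [] ∷ (complement ∷ [])
        ∷ (meetWith y6′ ∷ joinWith x6 ∷ meetWith y6 ∷ [])
        ∷ (joinWith y6′ ∷ meetWith y6 ∷ joinWith x6 ∷ []) ∷ []

B8-elements : List B8
B8-elements = o8 ∷ z8′ ∷ x8 ∷ y8 ∷ y8′ ∷ x8′ ∷ z8 ∷ i8 ∷ []

B8-complete : ∀ p → p ∈ B8-elements
B8-complete o8  = here refl
B8-complete z8′ = there (here refl)
B8-complete x8  = there (there (here refl))
B8-complete y8  = there (there (there (here refl)))
B8-complete y8′ = there (there (there (there (here refl))))
B8-complete x8′ = there (there (there (there (there (here refl)))))
B8-complete z8  = there (there (there (there (there (there (here refl))))))
B8-complete i8  = there (there (there (there (there (there (there (here refl)))))))

B8-presentation : Presentation 𝐁₈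
B8-presentation = record
  { _≤ᵇ_ = leq8 ; ⊓-default = z8′ ; ⊓-by-order = λ _ _ → refl
  ; order = order ; order-spanned = from-yes (orderSpannedBy? leq8 order)
  ; incomparable = incomparable ; incomparables = from-yes (incomparablesIn? leq8 incomparable)
  ; de-Morgan = from-yes deMorgan?
  ; tests = tests ; forbidden = forbidden ; separated = from-yes (separatedBy? tests forbidden)
  }
  where
  open Decision 𝐁₈ B8-elements B8-complete
  order incomparable forbidden : List (B8 × B8)
  order = (z8′ , x8) ∷ (z8′ , y8) ∷ (z8′ , y8′) ∷ (z8′ , x8′) ∷ (z8′ , z8)
        ∷ (x8 , y8) ∷ (x8 , z8) ∷ (y8 , z8) ∷ (y8′ , x8′) ∷ (y8′ , z8) ∷ (x8′ , z8) ∷ []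
  incomparable = (x8 , y8′) ∷ (x8 , x8′) ∷ (y8 , y8′) ∷ (y8 , x8′) ∷ []
  forbidden    = (x8 , y8) ∷ (o8 , z8′) ∷ []
  tests : List (Polynomial 𝐁₈)
  tests = [] ∷ (complement ∷ [])
        ∷ (meetWith y8′ ∷ joinWith x8 ∷ meetWith y8 ∷ [])
        ∷ (joinWith y8′ ∷ meetWith y8 ∷ joinWith x8 ∷ []) ∷ []

-- (SP1) for a bare signature; SP1 A unfolds to SP1ₛ (sig A).
SP1ₛ : ∀ {a} → PKSig a → Set a
SP1ₛ A = ∀ x y → x ≤ y → x ′ ⊓ y ≡ (x ⊓ x ′) ⊔ₗ (y ⊓ y ′) →
         y ⊓ (x ⊔ₗ x ′) ≡ x ⊔ₗ (y ⊓ y ′)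
  where open PKSig A

SP1-subalgebra : ∀ {a b} {A : PKSig a} {B : PKSig b} → Embedding B A → SP1ₛ A → SP1ₛ B
SP1-subalgebra {A = A} {B} e sp x y x≤y hyp = injective _ _ (begin
  f (y ⊓ᴮ (x ⊔ᴮ x ′ᴮ))        ≡⟨ trans (pres-⊓ y _) (cong (f y ⊓_) (f-⊔-′ x x)) ⟩
  f y ⊓ (f x ⊔ₗ f x ′)         ≡⟨ sp (f x) (f y) fx≤fy f-hyp ⟩
  f x ⊔ₗ (f y ⊓ f y ′)         ≡⟨ trans (pres-⊔ x _) (cong (f x ⊔ₗ_) (f-⊓-′ y y)) ⟨
  f (x ⊔ᴮ (y ⊓ᴮ y ′ᴮ))        ∎)
  where
  open PKSig A
  open PKSig B using () renaming (_⊓_ to _⊓ᴮ_; _⊔ₗ_ to _⊔ᴮ_; _′ to _′ᴮ)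
  open Embedding e
  open ≡-Reasoning

  f-⊓-′ : ∀ p q → f (p ⊓ᴮ q ′ᴮ) ≡ f p ⊓ f q ′
  f-⊓-′ p q = trans (pres-⊓ p _) (cong (f p ⊓_) (pres-′ q))

  f-⊔-′ : ∀ p q → f (p ⊔ᴮ q ′ᴮ) ≡ f p ⊔ₗ f q ′
  f-⊔-′ p q = trans (pres-⊔ p _) (cong (f p ⊔ₗ_) (pres-′ q))

  fx≤fy : f x ≤ f y
  fx≤fy = trans (sym (pres-⊓ x y)) (cong f x≤y)

  f-hyp : f x ′ ⊓ f y ≡ (f x ⊓ f x ′) ⊔ₗ (f y ⊓ f y ′)
  f-hyp = begin
    f x ′ ⊓ f y                         ≡⟨ trans (pres-⊓ _ y) (cong (_⊓ f y) (pres-′ x)) ⟨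
    f (x ′ᴮ ⊓ᴮ y)                       ≡⟨ cong f hyp ⟩
    f ((x ⊓ᴮ x ′ᴮ) ⊔ᴮ (y ⊓ᴮ y ′ᴮ))      ≡⟨ trans (pres-⊔ _ _) (cong₂ _⊔ₗ_ (f-⊓-′ x x) (f-⊓-′ y y)) ⟩
    (f x ⊓ f x ′) ⊔ₗ (f y ⊓ f y ′)      ∎

B6-violates-SP1 : ¬ SP1ₛ 𝐁₆
B6-violates-SP1 sp with sp x6 y6 refl refl
... | ()

B8-violates-SP1 : ¬ SP1ₛ 𝐁₈
B8-violates-SP1 sp with sp x8 y8 refl refl
... | ()

module SP1-Failure {a} (A : PseudoKleeneLattice a) where
  open PseudoKleeneLattice A
  open Properties A

  module _ {x y : Carrier} (x≤y : x ≤ y) (hyp : x ′ ⊓ y ≡ (x ⊓ x ′) ⊔ₗ (y ⊓ y ′)) where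

    c u v w : Carrier
    c = (x ⊓ x ′) ⊔ₗ (y ⊓ y ′)
    u = x ⊔ₗ (y ⊓ y ′)
    v = y ⊓ (x ⊔ₗ x ′)
    w = u ⊓ v ′

    u≤v : u ≤ v
    u≤v = ⊔-least (⊓-greatest x≤y (x≤x⊔y x (x ′))) (⊓-greatest (x⊓y≤x y (y ′)) (normal y x))

    c≤u : c ≤ u
    c≤u = ⊔-least (≤-trans (x⊓y≤x x (x ′)) (x≤x⊔y x _)) (y≤x⊔y x _)

    c≤v′ : c ≤ (v ′)
    c≤v′ = subst (c ≤_) (sym (⊓-′ y (x ⊔ₗ x ′)))
      (⊔-least (subst (_≤ (y ′ ⊔ₗ (x ⊔ₗ x ′) ′)) (sym (⊓-self-′ x)) (y≤x⊔y (y ′) _))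
               (≤-trans (x⊓y≤y y (y ′)) (x≤x⊔y (y ′) _)))

    squeeze : (v ⊓ u ′) ≤ (u ⊓ v ′)
    squeeze = ≤-trans (⊓-mono (x⊓y≤x y _) (′-antitone x u (x≤x⊔y x _)))
      (subst (_≤ (u ⊓ v ′)) (trans (sym hyp) (⊓-comm (x ′) y)) (⊓-greatest c≤u c≤v′))

    open MeetsWithComplements u≤v squeeze
      renaming (t′≤s′ to v′≤u′; s⊓s′≡s⊓t′ to u⊓u′≡w; t⊓t′≡s⊓t′ to v⊓v′≡w; t⊓s′≡s⊓t′ to v⊓u′≡w)

    w≤u : w ≤ u
    w≤u = x⊓y≤x u (v ′)

    w≤v′ : w ≤ (v ′)
    w≤v′ = x⊓y≤y u (v ′)

    w≤v : w ≤ v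
    w≤v = ≤-trans w≤u u≤v

    w≤u′ : w ≤ (u ′)
    w≤u′ = ≤-trans w≤v′ v′≤u′

    u≤w′ : u ≤ (w ′)
    u≤w′ = ′-swap w≤u′

    v≤w′ : v ≤ (w ′)
    v≤w′ = ′-swap w≤v′

    w≤w′ : w ≤ (w ′)
    w≤w′ = ≤-trans w≤u u≤w′

    B6-image : B6 → Carrier
    B6-image o6  = ⊥ₗ
    B6-image x6  = u
    B6-image y6  = v
    B6-image y6′ = v ′
    B6-image x6′ = u ′
    B6-image i6  = ⊤ₗ

    B6-image-′ : ∀ p → B6-image (neg6 p) ≡ B6-image p ′
    B6-image-′ o6  = sym ⊥-′
    B6-image-′ x6  = refl
    B6-image-′ y6  = refl
    B6-image-′ y6′ = sym (′-invol v)
    B6-image-′ x6′ = sym (′-invol u)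
    B6-image-′ i6  = sym ⊤-′

    B6-embedding : u ≢ v → w ≡ ⊥ₗ → Embedding 𝐁₆ sig
    B6-embedding u≢v w≡⊥ = EmbeddingCriterion.embedding A B6-presentation B6-image refl refl B6-image-′
      (u≤v ∷ v′≤u′ ∷ [])
      (w≡⊥ ∷ trans u⊓u′≡w w≡⊥ ∷ trans v⊓v′≡w w≡⊥ ∷ trans v⊓u′≡w w≡⊥ ∷ [])
      (u≢v ∷ [])

    B8-image : B8 → Carrier
    B8-image o8  = ⊥ₗ
    B8-image z8′ = w
    B8-image x8  = u
    B8-image y8  = v
    B8-image y8′ = v ′
    B8-image x8′ = u ′
    B8-image z8  = w ′
    B8-image i8  = ⊤ₗ

    B8-image-′ : ∀ p → B8-image (neg8 p) ≡ B8-image p ′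
    B8-image-′ o8  = sym ⊥-′
    B8-image-′ z8′ = refl
    B8-image-′ x8  = refl
    B8-image-′ y8  = refl
    B8-image-′ y8′ = sym (′-invol v)
    B8-image-′ x8′ = sym (′-invol u)
    B8-image-′ z8  = sym (′-invol w)
    B8-image-′ i8  = sym ⊤-′

    B8-embedding : u ≢ v → w ≢ ⊥ₗ → Embedding 𝐁₈ sig
    B8-embedding u≢v w≢⊥ = EmbeddingCriterion.embedding A B8-presentation B8-image refl refl B8-image-′
      (w≤u ∷ w≤v ∷ w≤v′ ∷ w≤u′ ∷ w≤w′ ∷ u≤v ∷ u≤w′ ∷ v≤w′ ∷ v′≤u′
        ∷ ′-antitone w v w≤v ∷ ′-antitone w u w≤u ∷ [])
      (refl ∷ u⊓u′≡w ∷ v⊓v′≡w ∷ v⊓u′≡w ∷ [])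
      (u≢v ∷ w≢⊥ ∘ sym ∷ [])

    subalgebra-of-failure : ExcludedMiddle a → v ≢ u →
      HasSubalgebraIsoTo 𝐁₆ sig ⊎ HasSubalgebraIsoTo 𝐁₈ sig
    subalgebra-of-failure em v≢u with em {w ≡ ⊥ₗ}
    ... | yes w≡⊥ = inj₁ (B6-embedding (v≢u ∘ sym) w≡⊥)
    ... | no  w≢⊥ = inj₂ (B8-embedding (v≢u ∘ sym) w≢⊥)

theorem3p2 : {a : Level} → ExcludedMiddle a → (A : PseudoKleeneLattice a) →
    SP1 A ⇔ (¬ HasSubalgebraIsoTo 𝐁₆ (PseudoKleeneLattice.sig A) × ¬ HasSubalgebraIsoTo 𝐁₈ (PseudoKleeneLattice.sig A))
theorem3p2 em A = mk⇔
  (λ sp → (λ e → B6-violates-SP1 (SP1-subalgebra e sp)) , (λ e → B8-violates-SP1 (SP1-subalgebra e sp)))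
  (λ (no-B6 , no-B8) x y x≤y hyp → decidable-stable em
    ([ no-B6 , no-B8 ]′ ∘ SP1-Failure.subalgebra-of-failure A x≤y hyp em))
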